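{- Let $G=(V,E)$ be a finite simple connected graph with diameter $d$. Suppose there exist integers $n_1,\dots,n_d\ge 1$ with $\sum_{i=1}^d n_i=|V|-1$ such that for every vertex $v\in V$ and every $1\le i\le d$ there are exactly $n_i$ vertices at distance $i$ from $v$. Then for every rank assignment $f:V\to\mathbb{R}$ under which all vertices have distinct strings, and all real $k\neq 0$ and $b$, the rank assignment $v\mapsto kf(v)+b$ also gives all vertices distinct strings. Furthermore, if in addition $IDI(G)=2$, then $G$ is an ID-graph.
   Context: For $f:V\to\mathbb{R}$ (a rank assignment), the string of $v$ under $f$ is the $d$-vector whose $i$-th coordinate is $\sum_{w:\ d(v,w)=i} f(w)$ ($d(\cdot,\cdot)$ = graph distance). $IDI(G)$ is the minimum $k$ such that some $f$ with $|f(V)|=k$ gives all vertices pairwise distinct strings. A red-white coloring of $G$ assigns red or white to each vertex, with at least one red vertex; the code of $v$ is the $d$-vector whose $i$-th coordinate is the number of red vertices at distance $i$ from $v$; it is an ID-coloring if all codes are distinct, and $G$ is an ID-graph if it has an ID-coloring. -}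

module Defs where

open import Level using (Level; _⊔_) renaming (suc to lsuc)
open import Data.Bool using (Bool; true; false; _∧_; _∨_; not; T; T?; if_then_else_)
open import Data.Nat using (ℕ; zero; suc; _≤_)
open import Data.Fin using (Fin; toℕ; _≟_)
open import Data.List using (List; foldr; filter; length)
open import Data.List.Base using (allFin)
open import Data.Product using (Σ; ∃; _×_; _,_)
open import Relation.Nullary using (¬_; does)
open import Relation.Unary using (Decidable)
open import Relation.Binary.PropositionalEquality using (_≡_; _≢_)
open import Algebra.Bundles using (CommutativeRing)

-- A field: a commutative ring with 0 ≠ 1 in which every nonzero element
-- has a multiplicative inverse (stands in for ℝ; the stdlib has no reals).
record Field (c ℓ : Level) : Set (lsuc (c ⊔ ℓ)) where
  field
    commutativeRing : CommutativeRing c ℓ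
  open CommutativeRing commutativeRing public
  field
    0≉1     : ¬ (0# ≈ 1#)
    inverse : ∀ x → ¬ (x ≈ 0#) → ∃ λ y → x * y ≈ 1#

record Graph : Set where
  field
    n     : ℕ
    adj   : Fin n → Fin n → Bool
    sym   : ∀ u v → adj u v ≡ adj v u
    irrefl : ∀ v → adj v v ≡ false

module _ (G : Graph) where
  open Graph G

  V : Set
  V = Fin n

  eqB : V → V → Bool
  eqB v w = does (v ≟ w)

  anyV : (V → Bool) → Bool
  anyV p = foldr (λ u b → p u ∨ b) false (allFin n)

  walk : ℕ → V → V → Bool
  walk zero    v w = eqB v w
  walk (suc k) v w = anyV (λ u → adj v u ∧ walk k u w)

  within : ℕ → V → V → Bool
  within zero    v w = walk zero v w
  within (suc k) v w = within k v w ∨ walk (suc k) v w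

  atDist : ℕ → V → V → Bool
  atDist zero    v w = eqB v w
  atDist (suc i) v w = within (suc i) v w ∧ not (within i v w)

  Connected : Set
  Connected = ∀ v w → ∃ λ k → T (within k v w)

  Diameter : ℕ → Set
  Diameter d = (∀ v w → T (within d v w)) × (∃ λ v → ∃ λ w → T (atDist d v w))

  countAt : ℕ → V → ℕ
  countAt i v = length (filter (λ w → T? (atDist i v w)) (allFin n))

  redCount : (V → Bool) → ℕ → V → ℕ
  redCount red i v =
    length (filter (λ w → T? (atDist i v w ∧ red w)) (allFin n))

  IsIDColoring : ℕ → (V → Bool) → Set
  IsIDColoring d red =
    (∃ λ v → T (red v)) ×
    (∀ v w → v ≢ w → ¬ (∀ (i : Fin d) → redCount red (suc (toℕ i)) v ≡ redCount red (suc (toℕ i)) w))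

  IsIDGraph : ℕ → Set
  IsIDGraph d = ∃ λ red → IsIDColoring d red

  module _ {c ℓ : Level} (K : Field c ℓ) where
    open Field K

    stringAt : (V → Carrier) → ℕ → V → Carrier
    stringAt f i v = foldr (λ w s → (if atDist i v w then f w else 0#) + s) 0# (allFin n)

    -- all vertices have pairwise distinct strings (d-vectors, coordinates 1..d)
    DistinctStrings : ℕ → (V → Carrier) → Set ℓ
    DistinctStrings d f =
      ∀ v w → v ≢ w → ¬ (∀ (i : Fin d) → stringAt f (suc (toℕ i)) v ≈ stringAt f (suc (toℕ i)) w)

    ImageSize : (V → Carrier) → ℕ → Set (c ⊔ ℓ)
    ImageSize f k = ∃ λ (g : Fin k → Carrier) →
      (∀ i j → g i ≈ g j → i ≡ j) ×
      (∀ v → ∃ λ i → f v ≈ g i) ×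
      (∀ i → ∃ λ v → f v ≈ g i)

    IDIis : ℕ → ℕ → Set (c ⊔ ℓ)
    IDIis d m =
      (∃ λ f → ImageSize f m × DistinctStrings d f) ×
      (∀ f k → ImageSize f k → DistinctStrings d f → m ≤ k)

sumFin : ∀ {d} → (Fin d → ℕ) → ℕ
sumFin {d} ns = Data.Vec.Functional.foldr Data.Nat._+_ 0 ns
  where import Data.Vec.Functional
        import Data.Nat

{-# OPTIONS --safe #-}
-- Since every vertex has the same number n_i of vertices at distance i, the
-- i-th string coordinate of k f + b at v is k s_i(v) + n_i b, where s_i(v) is
-- that of f: one affine map, independent of v, applied to the string of f.
-- For k ≠ 0 it is injective, so distinct strings stay distinct.  A rank
-- assignment with exactly two values g₀, g₁ equals (g₁ − g₀) χ + g₀ for the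
-- indicator χ of the vertices ranked g₁, and the string of χ is the code of
-- the colouring whose red vertices are those ranked g₁; so equal codes would
-- force equal strings.
module Submission where

open import Defs
open import Data.Nat using (ℕ; suc; _≤_; _∸_)
open import Data.Fin using (Fin; toℕ)
open import Data.Product using (_×_)
open import Relation.Nullary using (¬_)
open import Relation.Binary.PropositionalEquality using (_≡_)

open import Level using (Level)
open import Algebra.Bundles using (Semiring)
open import Data.Bool using (Bool; true; false; if_then_else_; T; T?; _∧_)
open import Data.Fin using () renaming (zero to 0F; suc to sucF)
open import Data.List using (List; []; _∷_; foldr; filter; length)
open import Data.List.Base using (allFin)
open import Data.Product using (_,_; ∃; ∃₂; proj₁; proj₂)
open import Data.Unit using (tt)
open import Relation.Binary.PropositionalEquality using (cong; cong₂; subst)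
import Relation.Binary.PropositionalEquality as ≡
import Algebra.Properties.CommutativeSemigroup as CommutativeSemigroupProperties
import Algebra.Properties.Group as GroupProperties
import Algebra.Properties.Monoid.Mult as MonoidMultiplication
import Relation.Binary.Reasoning.Setoid as SetoidReasoning

module FilteredSum {c ℓ : Level} (R : Semiring c ℓ) where
  open Semiring R
  open MonoidMultiplication +-monoid public using () renaming (_×_ to _·_)
  open CommutativeSemigroupProperties +-commutativeSemigroup using (interchange)
  open SetoidReasoning setoid

  sumWhere : {A : Set} → (A → Bool) → (A → Carrier) → List A → Carrier
  sumWhere p f = foldr (λ x s → (if p x then f x else 0#) + s) 0#

  countWhere : {A : Set} → (A → Bool) → List A → ℕ
  countWhere p xs = length (filter (λ x → T? (p x)) xs)

  indicator : {A : Set} → (A → Bool) → A → Carrier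
  indicator q x = if q x then 1# else 0#

  sumWhere-cong : {A : Set} (p : A → Bool) {f g : A → Carrier} (xs : List A) →
    (∀ x → f x ≈ g x) → sumWhere p f xs ≈ sumWhere p g xs
  sumWhere-cong p []       f≈g = refl
  sumWhere-cong p (x ∷ xs) f≈g with p x
  ... | true  = +-cong (f≈g x) (sumWhere-cong p xs f≈g)
  ... | false = +-congˡ (sumWhere-cong p xs f≈g)

  sumWhere-affine : {A : Set} (p : A → Bool) (f : A → Carrier) (k b : Carrier) (xs : List A) →
    sumWhere p (λ x → k * f x + b) xs ≈ k * sumWhere p f xs + countWhere p xs · b
  sumWhere-affine p f k b [] = begin
    0#          ≈⟨ zeroʳ k ⟨
    k * 0#      ≈⟨ +-identityʳ _ ⟨
    k * 0# + 0# ∎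
  sumWhere-affine p f k b (x ∷ xs) with p x
  ... | true = begin
    (k * f x + b) + sumWhere p (λ y → k * f y + b) xs
      ≈⟨ +-congˡ (sumWhere-affine p f k b xs) ⟩
    (k * f x + b) + (k * sumWhere p f xs + countWhere p xs · b)
      ≈⟨ interchange _ _ _ _ ⟩
    (k * f x + k * sumWhere p f xs) + (b + countWhere p xs · b)
      ≈⟨ +-congʳ (distribˡ k (f x) (sumWhere p f xs)) ⟨
    k * (f x + sumWhere p f xs) + (b + countWhere p xs · b) ∎
  ... | false = begin
    0# + sumWhere p (λ y → k * f y + b) xs
      ≈⟨ +-identityˡ _ ⟩
    sumWhere p (λ y → k * f y + b) xs
      ≈⟨ sumWhere-affine p f k b xs ⟩
    k * sumWhere p f xs + countWhere p xs · b
      ≈⟨ +-congʳ (*-congˡ (+-identityˡ _)) ⟨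
    k * (0# + sumWhere p f xs) + countWhere p xs · b ∎

  sumWhere-indicator : {A : Set} (p q : A → Bool) (xs : List A) →
    sumWhere p (indicator q) xs ≈ countWhere (λ x → p x ∧ q x) xs · 1#
  sumWhere-indicator p q [] = refl
  sumWhere-indicator p q (x ∷ xs) with p x | q x
  ... | true  | true  = +-congˡ (sumWhere-indicator p q xs)
  ... | true  | false = trans (+-identityˡ _) (sumWhere-indicator p q xs)
  ... | false | _     = trans (+-identityˡ _) (sumWhere-indicator p q xs)

module _ {c ℓ : Level} (K : Field c ℓ) where
  open Field K
  open SetoidReasoning setoid

  *-cancelˡ-≉0 : ∀ {k x y} → ¬ (k ≈ 0#) → k * x ≈ k * y → x ≈ y
  *-cancelˡ-≉0 {k} {x} {y} k≉0 kx≈ky with inverse k k≉0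
  ... | k⁻¹ , kk⁻¹≈1 = begin
    x               ≈⟨ *-identityˡ x ⟨
    1# * x          ≈⟨ *-congʳ (trans (*-comm k⁻¹ k) kk⁻¹≈1) ⟨
    (k⁻¹ * k) * x   ≈⟨ *-assoc k⁻¹ k x ⟩
    k⁻¹ * (k * x)   ≈⟨ *-congˡ kx≈ky ⟩
    k⁻¹ * (k * y)   ≈⟨ *-assoc k⁻¹ k y ⟨
    (k⁻¹ * k) * y   ≈⟨ *-congʳ (trans (*-comm k⁻¹ k) kk⁻¹≈1) ⟩
    1# * y          ≈⟨ *-identityˡ y ⟩
    y               ∎

module _ (G : Graph) where
  open Graph G using (n)

  UniformDistanceCounts : ℕ → Set
  UniformDistanceCounts d =
    ∀ v w (i : Fin d) → countAt G (suc (toℕ i)) v ≡ countAt G (suc (toℕ i)) w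

  module _ {c ℓ : Level} (K : Field c ℓ) where
    open Field K
    open FilteredSum semiring
    open GroupProperties +-group using () renaming (∙-cancelʳ to +-cancelʳ)
    open SetoidReasoning setoid

    stringAt-affine : (f : V G → Carrier) (k b : Carrier) (i : ℕ) (v : V G) →
      stringAt G K (λ u → k * f u + b) i v ≈ k * stringAt G K f i v + countAt G i v · b
    stringAt-affine f k b i v = sumWhere-affine (atDist G i v) f k b (allFin n)

    DistinctStrings-affine : ∀ {d} {f : V G → Carrier} {k} b →
      UniformDistanceCounts d → ¬ (k ≈ 0#) →
      DistinctStrings G K d f → DistinctStrings G K d (λ v → k * f v + b)
    DistinctStrings-affine {f = f} {k} b uniform k≉0 distinct v w v≢w same =
      distinct v w v≢w λ i → let j = suc (toℕ i) in
        *-cancelˡ-≉0 K k≉0 (+-cancelʳ (countAt G j v · b) _ _ (begin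
          k * stringAt G K f j v + countAt G j v · b  ≈⟨ stringAt-affine f k b j v ⟨
          stringAt G K (λ u → k * f u + b) j v        ≈⟨ same i ⟩
          stringAt G K (λ u → k * f u + b) j w        ≈⟨ stringAt-affine f k b j w ⟩
          k * stringAt G K f j w + countAt G j w · b  ≡⟨ cong (λ m → _ + m · b) (uniform v w i) ⟨
          k * stringAt G K f j w + countAt G j v · b  ∎))

    ImageSize-2⇒affine-indicator : ∀ {f : V G → Carrier} → ImageSize G K f 2 →
      ∃ λ red → (∃ λ v → T (red v)) × ∃₂ λ k b → ∀ v → f v ≈ k * indicator red v + b
    ImageSize-2⇒affine-indicator {f} (g , g-injective , f-covered , g-attained) =
      red , red-nonempty , g (sucF 0F) - g 0F , g 0F , λ v → trans (proj₂ (f-covered v)) (g-affine (proj₁ (f-covered v)))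
      where
      isOne : Fin 2 → Bool
      isOne 0F       = false
      isOne (sucF _) = true

      red : V G → Bool
      red v = isOne (proj₁ (f-covered v))

      g-affine : ∀ j → g j ≈ (g (sucF 0F) - g 0F) * (if isOne j then 1# else 0#) + g 0F
      g-affine 0F = begin
        g 0F                          ≈⟨ +-identityˡ _ ⟨
        0# + g 0F                     ≈⟨ +-congʳ (zeroʳ _) ⟨
        (g (sucF 0F) - g 0F) * 0# + g 0F ∎
      g-affine (sucF 0F) = begin
        g (sucF 0F)                        ≈⟨ +-identityʳ _ ⟨
        g (sucF 0F) + 0#                   ≈⟨ +-congˡ (-‿inverseˡ (g 0F)) ⟨
        g (sucF 0F) + (- g 0F + g 0F)      ≈⟨ +-assoc _ _ _ ⟨
        (g (sucF 0F) - g 0F) + g 0F        ≈⟨ +-congʳ (*-identityʳ _) ⟨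
        (g (sucF 0F) - g 0F) * 1# + g 0F   ∎

      red-nonempty : ∃ λ v → T (red v)
      red-nonempty with g-attained (sucF 0F)
      ... | v , fv≈g1 = v , subst (λ j → T (isOne j))
        (g-injective _ _ (trans (sym fv≈g1) (proj₂ (f-covered v)))) tt

    IDColoring-of-affine-indicator : ∀ {d} {f : V G → Carrier} {red k b} →
      UniformDistanceCounts d → (∃ λ v → T (red v)) →
      (∀ v → f v ≈ k * indicator red v + b) →
      DistinctStrings G K d f → IsIDColoring G d red
    IDColoring-of-affine-indicator {f = f} {red} {k} {b} uniform red-nonempty f≈ distinct =
      red-nonempty , λ v w v≢w sameCodes → distinct v w v≢w λ i → let j = suc (toℕ i) in begin
        stringAt G K f j v                                  ≈⟨ stringAt-via-code j v ⟩
        k * (redCount G red j v · 1#) + countAt G j v · b   ≡⟨ cong₂ (λ r m → k * (r · 1#) + m · b) (sameCodes i) (uniform v w i) ⟩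
        k * (redCount G red j w · 1#) + countAt G j w · b   ≈⟨ stringAt-via-code j w ⟨
        stringAt G K f j w                                  ∎
      where
      stringAt-via-code : ∀ j u → stringAt G K f j u ≈ k * (redCount G red j u · 1#) + countAt G j u · b
      stringAt-via-code j u = begin
        stringAt G K f j u                                      ≈⟨ sumWhere-cong (atDist G j u) (allFin n) f≈ ⟩
        stringAt G K (λ x → k * indicator red x + b) j u        ≈⟨ stringAt-affine (indicator red) k b j u ⟩
        k * stringAt G K (indicator red) j u + countAt G j u · b ≈⟨ +-congʳ (*-congˡ (sumWhere-indicator (atDist G j u) red (allFin n))) ⟩
        k * (redCount G red j u · 1#) + countAt G j u · b       ∎

lemma4 : ∀ {c ℓ} (K : Field c ℓ) (G : Graph) (d : ℕ) →
    Connected G → Diameter G d →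
    (ns : Fin d → ℕ) → (∀ i → 1 ≤ ns i) →
    sumFin ns ≡ Graph.n G ∸ 1 →
    (∀ (v : V G) (i : Fin d) → countAt G (suc (toℕ i)) v ≡ ns i) →
    let open Field K in
    ((f : V G → Carrier) → DistinctStrings G K d f →
      (k b : Carrier) → ¬ (k ≈ 0#) →
      DistinctStrings G K d (λ v → k * f v + b))
    × (IDIis G K d 2 → IsIDGraph G d)
lemma4 K G d _ _ _ _ _ counts =
  (λ f distinct k b k≉0 → DistinctStrings-affine G K b uniform k≉0 distinct) ,
  λ where
    ((f , twoValued , distinct) , _) →
      let red , red-nonempty , k , b , f≈ = ImageSize-2⇒affine-indicator G K twoValued
      in red , IDColoring-of-affine-indicator G K uniform red-nonempty f≈ distinct
  where
  uniform : UniformDistanceCounts G d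
  uniform v w i = ≡.trans (counts v i) (≡.sym (counts w i))
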